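{- Let $A \in \mathbb{F}^{n \times n}$ and let $D \in \mathbb{F}^{n\times n}$ be a diagonal matrix such that $A + D$ is invertible. Let $C \in \mathbb{F}^{n\times n}$ be principal minor equivalent to $(A+D)^{ -1}$. Then $C$ is invertible and $C^{ -1} - D$ is principal minor equivalent to $A$.
   Context: Two matrices $M, N \in \mathbb{F}^{n\times n}$ are principal minor equivalent if $\det(M[S]) = \det(N[S])$ for every nonempty $S \subseteq [n]$, where $M[S]$ denotes the principal submatrix with rows and columns indexed by $S$. -}

module Defs where

open import Level using (Level; _⊔_) renaming (suc to lsuc)
open import Algebra.Bundles using (CommutativeRing)
open import Data.Nat using (ℕ; zero; suc)
open import Data.Fin using (Fin; zero; suc; toℕ; punchIn)
open import Data.Vec using ([]; _∷_)
open import Data.Bool using (true; false)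
open import Data.Fin.Subset using (Subset; Nonempty)
open import Data.Product using (∃; _×_)
open import Relation.Nullary using (¬_)
open import Relation.Binary.PropositionalEquality using (_≡_)

record Field (c ℓ : Level) : Set (lsuc (c ⊔ ℓ)) where
  field
    commutativeRing : CommutativeRing c ℓ
  open CommutativeRing commutativeRing public
  field
    1≉0 : ¬ (1# ≈ 0#)
    inverse : ∀ x → ¬ (x ≈ 0#) → ∃ λ y → (x * y) ≈ 1#

module MatrixOver {c ℓ : Level} (F : Field c ℓ) where
  open Field F hiding (zero)

  Matrix : ℕ → Set c
  Matrix n = Fin n → Fin n → Carrier

  Σ : ∀ {n} → (Fin n → Carrier) → Carrier
  Σ {zero}  f = 0#
  Σ {suc n} f = f zero + Σ (λ i → f (suc i))

  _≈ᴹ_ : ∀ {n} → Matrix n → Matrix n → Set ℓ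
  M ≈ᴹ N = ∀ i j → M i j ≈ N i j

  _+ᴹ_ : ∀ {n} → Matrix n → Matrix n → Matrix n
  (M +ᴹ N) i j = M i j + N i j

  _-ᴹ_ : ∀ {n} → Matrix n → Matrix n → Matrix n
  (M -ᴹ N) i j = M i j - N i j

  _*ᴹ_ : ∀ {n} → Matrix n → Matrix n → Matrix n
  (M *ᴹ N) i j = Σ (λ k → M i k * N k j)

  δ : ∀ {n} → Fin n → Fin n → Carrier
  δ zero    zero    = 1#
  δ zero    (suc j) = 0#
  δ (suc i) zero    = 0#
  δ (suc i) (suc j) = δ i j

  Iᴹ : ∀ {n} → Matrix n
  Iᴹ = δ

  IsInverse : ∀ {n} → Matrix n → Matrix n → Set ℓ
  IsInverse M N = ((M *ᴹ N) ≈ᴹ Iᴹ) × ((N *ᴹ M) ≈ᴹ Iᴹ)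

  Invertible : ∀ {n} → Matrix n → Set (c ⊔ ℓ)
  Invertible M = ∃ λ N → IsInverse M N

  IsDiagonal : ∀ {n} → Matrix n → Set ℓ
  IsDiagonal D = ∀ i j → ¬ (i ≡ j) → D i j ≈ 0#

  sgn : ℕ → Carrier
  sgn zero    = 1#
  sgn (suc k) = - sgn k

  det : ∀ {n} → Matrix n → Carrier
  det {zero}  M = 1#
  det {suc n} M =
    Σ (λ j → sgn (toℕ j) * (M zero j * det (λ r s → M (suc r) (punchIn j s))))

  card : ∀ {n} → Subset n → ℕ
  card []          = zero
  card (true ∷ S)  = suc (card S)
  card (false ∷ S) = card S

  elem : ∀ {n} (S : Subset n) → Fin (card S) → Fin n
  elem (true ∷ S)  zero    = zero
  elem (true ∷ S)  (suc i) = suc (elem S i)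
  elem (false ∷ S) i       = suc (elem S i)

  sub : ∀ {n} → Matrix n → (S : Subset n) → Matrix (card S)
  sub M S i j = M (elem S i) (elem S j)

  PME : ∀ {n} → Matrix n → Matrix n → Set ℓ
  PME {n} M N = ∀ (S : Subset n) → Nonempty S → det (sub M S) ≈ det (sub N S)

-- Write det (idOutside P M) for the principal minor of M on P: the rows outside P are replaced
-- by unit rows. Jacobi's complementary minor formula det (C⁻¹[P]) · det C = det (C[∁P]) shows
-- that principal minor equivalence of C and B = (A + D)⁻¹, which in particular gives
-- det C = det B ≠ 0, passes to the inverses C⁻¹ and A + D. Subtracting a from the k-th diagonal
-- entry changes a principal minor on P ∋ k by -a times the minor on P ∖ {k} and leaves the
-- others alone, so principal minor equivalence survives subtracting D entry by entry.
module Submission where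

open import Level using (_⊔_)
open import Defs
open import Data.Nat using (ℕ; zero; suc)
open import Data.Fin using (Fin; zero; suc; toℕ; punchIn; punchOut; lift; _≟_)
open import Data.Fin.Properties using (punchIn-punchOut; punchInᵢ≢i; suc-injective; any?)
open import Data.Fin.Subset using (Subset)
open import Data.Vec as Vec using (lookup; tabulate)
open import Data.Vec.Properties using (lookup⇒[]=; lookup∘tabulate)
open import Data.Vec.Functional using (_∷_; updateAt; insertAt; removeAt)
open import Data.Maybe as Maybe using (Maybe; just; nothing; maybe′)
open import Data.Maybe.Properties using (just-injective)
open import Data.Vec.Functional.Properties
  using (updateAt-updates; updateAt-minimal; updateAt-id-local; map-updateAt; insertAt-lookup; insertAt-punchIn)
open import Data.Product using (Σ-syntax; _×_; _,_; proj₁; proj₂)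
open import Data.Sum using (_⊎_; inj₁; inj₂)
open import Data.Bool as Bool using (Bool; true; false; not; if_then_else_)
open import Function using (_∘_; const)
open import Relation.Nullary using (¬_; yes; no; does; contradiction)
open import Relation.Binary.PropositionalEquality as P using (_≡_; _≢_)

module Properties {c ℓ} (F : Field c ℓ) where
  open Field F hiding (zero)
  open MatrixOver F
  open import Relation.Binary.Reasoning.Setoid setoid
  open import Algebra.Properties.Ring ring using (-1*x≈-x; -‿distribˡ-*; -‿distribʳ-*; x+x≈x⇒x≈0)
  open import Algebra.Properties.Group +-group using (inverseʳ-unique; ε⁻¹≈ε; ⁻¹-involutive; x≈y⇒x∙y⁻¹≈ε)
  open import Algebra.Properties.AbelianGroup +-abelianGroup using (⁻¹-∙-comm)
  open import Algebra.Properties.CommutativeSemigroup *-commutativeSemigroup using (x∙yz≈y∙xz)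
  open import Algebra.Properties.Semiring.Sum semiring
    using (sum; sum-cong-≋; sum-replicate-zero; ∑-distrib-+; *-distribˡ-sum; *-distribʳ-sum)

  ≡⇒≈ : ∀ {x y} → x ≡ y → x ≈ y
  ≡⇒≈ P.refl = refl

  x-0≈x : ∀ x → x - 0# ≈ x
  x-0≈x x = trans (+-congˡ ε⁻¹≈ε) (+-identityʳ x)

  x-y+y≈x : ∀ x y → (x - y) + y ≈ x
  x-y+y≈x x y = trans (+-assoc x (- y) y) (trans (+-congˡ (-‿inverseˡ y)) (+-identityʳ x))

  *-cancelʳ-nonzero : ∀ {a b d} → ¬ (d ≈ 0#) → a * d ≈ b * d → a ≈ b
  *-cancelʳ-nonzero {a} {b} {d} d≉0 ad≈bd = begin
    a             ≈⟨ *-identityʳ a ⟨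
    a * 1#        ≈⟨ *-congˡ d*d⁻¹≈1 ⟨
    a * (d * d⁻¹) ≈⟨ *-assoc a d d⁻¹ ⟨
    (a * d) * d⁻¹ ≈⟨ *-congʳ ad≈bd ⟩
    (b * d) * d⁻¹ ≈⟨ *-assoc b d d⁻¹ ⟩
    b * (d * d⁻¹) ≈⟨ *-congˡ d*d⁻¹≈1 ⟩
    b * 1#        ≈⟨ *-identityʳ b ⟩
    b             ∎
    where
    d⁻¹ = proj₁ (inverse d d≉0)
    d*d⁻¹≈1 = proj₂ (inverse d d≉0)

  *≈1⇒≉0 : ∀ a b → a * b ≈ 1# → ¬ (b ≈ 0#)
  *≈1⇒≉0 a b ab≈1 b≈0 = 1≉0 (trans (sym ab≈1) (trans (*-congˡ b≈0) (zeroʳ a)))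

  sgn-square : ∀ k → sgn k * sgn k ≈ 1#
  sgn-square zero    = *-identityˡ 1#
  sgn-square (suc k) = begin
    (- sgn k) * (- sgn k)  ≈⟨ -‿distribˡ-* (sgn k) (- sgn k) ⟨
    - (sgn k * (- sgn k))  ≈⟨ -‿cong (-‿distribʳ-* (sgn k) (sgn k)) ⟨
    - (- (sgn k * sgn k))  ≈⟨ ⁻¹-involutive _ ⟩
    sgn k * sgn k          ≈⟨ sgn-square k ⟩
    1#                     ∎

  Σ≡sum : ∀ {n} (f : Fin n → Carrier) → Σ f ≡ sum f
  Σ≡sum {zero}  f = P.refl
  Σ≡sum {suc n} f = P.cong (f zero +_) (Σ≡sum (f ∘ suc))

  Σ-cong : ∀ {n} {f g : Fin n → Carrier} → (∀ i → f i ≈ g i) → Σ f ≈ Σ g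
  Σ-cong {f = f} {g} f≈g rewrite Σ≡sum f | Σ≡sum g = sum-cong-≋ f≈g

  Σ-zero : ∀ {n} {f : Fin n → Carrier} → (∀ i → f i ≈ 0#) → Σ f ≈ 0#
  Σ-zero {n} {f} f≈0 rewrite Σ≡sum f = trans (sum-cong-≋ f≈0) (sum-replicate-zero n)

  Σ-distrib-+ : ∀ {n} (f g : Fin n → Carrier) → Σ (λ i → f i + g i) ≈ Σ f + Σ g
  Σ-distrib-+ f g rewrite Σ≡sum (λ i → f i + g i) | Σ≡sum f | Σ≡sum g = ∑-distrib-+ f g

  *-distribˡ-Σ : ∀ {n} a (f : Fin n → Carrier) → a * Σ f ≈ Σ (λ i → a * f i)
  *-distribˡ-Σ a f rewrite Σ≡sum f | Σ≡sum (λ i → a * f i) = *-distribˡ-sum a f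

  *-distribʳ-Σ : ∀ {n} a (f : Fin n → Carrier) → Σ f * a ≈ Σ (λ i → f i * a)
  *-distribʳ-Σ a f rewrite Σ≡sum f | Σ≡sum (λ i → f i * a) = *-distribʳ-sum a f

  -‿distrib-Σ : ∀ {n} (f : Fin n → Carrier) → - Σ f ≈ Σ (λ i → - f i)
  -‿distrib-Σ f = begin
    - Σ f                  ≈⟨ -1*x≈-x (Σ f) ⟨
    - 1# * Σ f             ≈⟨ *-distribˡ-Σ (- 1#) f ⟩
    Σ (λ i → - 1# * f i)   ≈⟨ Σ-cong (λ i → -1*x≈-x (f i)) ⟩
    Σ (λ i → - f i)        ∎

  Σ-comm : ∀ {n m} (f : Fin n → Fin m → Carrier) →
           Σ (λ i → Σ (f i)) ≈ Σ (λ j → Σ (λ i → f i j))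
  Σ-comm {zero} {m} f = sym (Σ-zero {m} (λ _ → refl))
  Σ-comm {suc n} f = trans (+-congˡ (Σ-comm (f ∘ suc))) (sym (Σ-distrib-+ (f zero) _))

  δ-refl : ∀ {n} (i : Fin n) → δ i i ≈ 1#
  δ-refl zero    = refl
  δ-refl (suc i) = δ-refl i

  δ-≢ : ∀ {n} {i j : Fin n} → i ≢ j → δ i j ≈ 0#
  δ-≢ {i = zero}  {zero}  i≢j = contradiction P.refl i≢j
  δ-≢ {i = zero}  {suc j} i≢j = refl
  δ-≢ {i = suc i} {zero}  i≢j = refl
  δ-≢ {i = suc i} {suc j} i≢j = δ-≢ (i≢j ∘ P.cong suc)

  δ-sym : ∀ {n} (i j : Fin n) → δ i j ≈ δ j i
  δ-sym zero    zero    = refl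
  δ-sym zero    (suc j) = refl
  δ-sym (suc i) zero    = refl
  δ-sym (suc i) (suc j) = δ-sym i j

  δ-punchIn : ∀ {n} (p : Fin (suc n)) (i j : Fin n) → δ (punchIn p i) (punchIn p j) ≈ δ i j
  δ-punchIn zero    i       j       = refl
  δ-punchIn (suc p) zero    zero    = refl
  δ-punchIn (suc p) zero    (suc j) = refl
  δ-punchIn (suc p) (suc i) zero    = refl
  δ-punchIn (suc p) (suc i) (suc j) = δ-punchIn p i j

  Σ-*δ : ∀ {n} (f : Fin n → Carrier) (j : Fin n) → Σ (λ k → f k * δ k j) ≈ f j
  Σ-*δ f zero = begin
    f zero * 1# + Σ (λ k → f (suc k) * 0#)  ≈⟨ +-cong (*-identityʳ (f zero)) (Σ-zero (λ k → zeroʳ (f (suc k)))) ⟩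
    f zero + 0#                              ≈⟨ +-identityʳ (f zero) ⟩
    f zero                                   ∎
  Σ-*δ f (suc j) = begin
    f zero * 0# + Σ (λ k → f (suc k) * δ k j)  ≈⟨ +-cong (zeroʳ (f zero)) (Σ-*δ (f ∘ suc) j) ⟩
    0# + f (suc j)                             ≈⟨ +-identityˡ _ ⟩
    f (suc j)                                  ∎

  Σ-δ* : ∀ {n} (f : Fin n → Carrier) (j : Fin n) → Σ (λ k → δ j k * f k) ≈ f j
  Σ-δ* f j = trans (Σ-cong (λ k → trans (*-comm (δ j k) (f k)) (*-congˡ (δ-sym j k)))) (Σ-*δ f j)

  Row : ℕ → Set c
  Row k = Fin k → Carrier

  Rows : ℕ → ℕ → Set c
  Rows n k = Fin n → Row k

  _≋_ : ∀ {n k} → Rows n k → Rows n k → Set ℓ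
  M ≋ N = ∀ i j → M i j ≈ N i j

  ≋-sym : ∀ {n k} {M N : Rows n k} → M ≋ N → N ≋ M
  ≋-sym M≋N i j = sym (M≋N i j)

  ≋-trans : ∀ {n k} {L M N : Rows n k} → L ≋ M → M ≋ N → L ≋ N
  ≋-trans L≋M M≋N i j = trans (L≋M i j) (M≋N i j)

  _[_]≔_ : ∀ {n} {A : Set c} → (Fin n → A) → Fin n → A → (Fin n → A)
  xs [ r ]≔ x = updateAt xs r (const x)

  []≔-updates : ∀ {n} {A : Set c} (xs : Fin n → A) r x → (xs [ r ]≔ x) r ≡ x
  []≔-updates xs r x = updateAt-updates r xs

  []≔-minimal : ∀ {n} {A : Set c} (xs : Fin n → A) r x {i} → i ≢ r → (xs [ r ]≔ x) i ≡ xs i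
  []≔-minimal xs r x i≢r = updateAt-minimal _ r xs i≢r

  []≔-punchIn : ∀ {n} {A : Set c} (xs : Fin (suc n) → A) r x k → (xs [ r ]≔ x) (punchIn r k) ≡ xs (punchIn r k)
  []≔-punchIn xs r x k = []≔-minimal xs r x (punchInᵢ≢i r k)

  map-[]≔ : ∀ {n} {A B : Set c} (f : A → B) (xs : Fin n → A) r x i → f ((xs [ r ]≔ x) i) ≡ ((f ∘ xs) [ r ]≔ f x) i
  map-[]≔ f xs r x = map-updateAt {f = f} {g = const x} {h = const (f x)} (λ _ → P.refl) xs r

  []≔-id : ∀ {n k} (M : Rows n k) r → (M [ r ]≔ M r) ≋ M
  []≔-id M r i j = ≡⇒≈ (P.cong (λ row → row j) (updateAt-id-local r M P.refl i))

  []≔-congʳ : ∀ {n k} (M : Rows n k) r {x y : Row k} → (∀ j → x j ≈ y j) → (M [ r ]≔ x) ≋ (M [ r ]≔ y)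
  []≔-congʳ M r {x} {y} x≈y i j with i ≟ r
  ... | yes P.refl rewrite []≔-updates M i x | []≔-updates M i y = x≈y j
  ... | no i≢r rewrite []≔-minimal M r x i≢r | []≔-minimal M r y i≢r = refl

  ∷-[]≔ : ∀ {m k} (x : Row k) (M : Rows m k) r y → (x ∷ (M [ r ]≔ y)) ≋ ((x ∷ M) [ suc r ]≔ y)
  ∷-[]≔ x M r y zero    j = refl
  ∷-[]≔ x M r y (suc i) j = refl

  -- Multilinear and alternating functions of the rows

  record IsMultilinear {n k} (φ : Rows n k → Carrier) : Set (c ⊔ ℓ) where
    field
      cong   : ∀ {M N} → M ≋ N → φ M ≈ φ N
      linear : ∀ M r a (u v : Row k) →
               φ (M [ r ]≔ (λ j → a * u j + v j)) ≈ a * φ (M [ r ]≔ u) + φ (M [ r ]≔ v)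

    additive : ∀ M r (u v : Row k) → φ (M [ r ]≔ (λ j → u j + v j)) ≈ φ (M [ r ]≔ u) + φ (M [ r ]≔ v)
    additive M r u v = begin
      φ (M [ r ]≔ (λ j → u j + v j))        ≈⟨ cong ([]≔-congʳ M r (λ j → +-congʳ (sym (*-identityˡ (u j))))) ⟩
      φ (M [ r ]≔ (λ j → 1# * u j + v j))   ≈⟨ linear M r 1# u v ⟩
      1# * φ (M [ r ]≔ u) + φ (M [ r ]≔ v)  ≈⟨ +-congʳ (*-identityˡ _) ⟩
      φ (M [ r ]≔ u) + φ (M [ r ]≔ v)       ∎

    zero-row : ∀ M r → φ (M [ r ]≔ (λ _ → 0#)) ≈ 0#
    zero-row M r = x+x≈x⇒x≈0 _ (sym (trans (cong ([]≔-congʳ M r (λ _ → sym (+-identityˡ 0#))))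
                                          (additive M r _ _)))

    linear-Σ : ∀ {t} M r (a : Fin t → Carrier) (u : Fin t → Row k) →
               φ (M [ r ]≔ (λ j → Σ (λ i → a i * u i j))) ≈ Σ (λ i → a i * φ (M [ r ]≔ u i))
    linear-Σ {zero}  M r a u = zero-row M r
    linear-Σ {suc t} M r a u =
      trans (linear M r (a zero) (u zero) _) (+-congˡ (linear-Σ M r (a ∘ suc) (u ∘ suc)))

  swap₀₁ : ∀ {m k} → Rows (suc (suc m)) k → Rows (suc (suc m)) k
  swap₀₁ M = M (suc zero) ∷ M zero ∷ λ i → M (suc (suc i))

  -- Expanding φ (x + y ∷ x + y ∷ R) = 0 bilinearly leaves φ (x ∷ y ∷ R) + φ (y ∷ x ∷ R) = 0.
  swap₀₁-antisym : ∀ {m k} {φ : Rows (suc (suc m)) k → Carrier} → IsMultilinear φ →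
                   (∀ M → (∀ t → M zero t ≈ M (suc zero) t) → φ M ≈ 0#) →
                   ∀ M → φ (swap₀₁ M) ≈ - φ M
  swap₀₁-antisym {m} {k} {φ} ml alternating₀₁ M =
    trans (inverseʳ-unique (ψ x y) (ψ y x) ψxy+ψyx≈0) (-‿cong (cong M≋xyR))
    where
    open IsMultilinear ml
    R : Rows m k
    R i = M (suc (suc i))
    x = M zero
    y = M (suc zero)
    ψ : Row k → Row k → Carrier
    ψ u v = φ (u ∷ v ∷ R)
    M≋xyR : (x ∷ y ∷ R) ≋ M
    M≋xyR zero          j = refl
    M≋xyR (suc zero)    j = refl
    M≋xyR (suc (suc i)) j = refl
    at₀ : ∀ u v w → ((u ∷ v ∷ R) [ zero ]≔ w) ≋ (w ∷ v ∷ R)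
    at₀ u v w zero    j = refl
    at₀ u v w (suc i) j = refl
    at₁ : ∀ u v w → ((u ∷ v ∷ R) [ suc zero ]≔ w) ≋ (u ∷ w ∷ R)
    at₁ u v w zero          j = refl
    at₁ u v w (suc zero)    j = refl
    at₁ u v w (suc (suc i)) j = refl
    additiveˡ : ∀ u u' v → ψ (λ j → u j + u' j) v ≈ ψ u v + ψ u' v
    additiveˡ u u' v = trans (sym (cong (at₀ u v _)))
      (trans (additive (u ∷ v ∷ R) zero u u') (+-cong (cong (at₀ u v u)) (cong (at₀ u v u'))))
    additiveʳ : ∀ u v v' → ψ u (λ j → v j + v' j) ≈ ψ u v + ψ u v'
    additiveʳ u v v' = trans (sym (cong (at₁ u v _)))
      (trans (additive (u ∷ v ∷ R) (suc zero) v v') (+-cong (cong (at₁ u v v)) (cong (at₁ u v v'))))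
    ψ-diag : ∀ u → ψ u u ≈ 0#
    ψ-diag u = alternating₀₁ (u ∷ u ∷ R) (λ _ → refl)
    s = λ j → x j + y j
    ψxy+ψyx≈0 : ψ x y + ψ y x ≈ 0#
    ψxy+ψyx≈0 = sym (begin
      0#                                      ≈⟨ ψ-diag s ⟨
      ψ s s                                   ≈⟨ additiveˡ x y s ⟩
      ψ x s + ψ y s                           ≈⟨ +-cong (additiveʳ x x y) (additiveʳ y x y) ⟩
      (ψ x x + ψ x y) + (ψ y x + ψ y y)       ≈⟨ +-cong (+-congʳ (ψ-diag x)) (+-congˡ (ψ-diag y)) ⟩
      (0# + ψ x y) + (ψ y x + 0#)             ≈⟨ +-cong (+-identityˡ _) (+-identityʳ _) ⟩
      ψ x y + ψ y x                           ∎)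

  record IsAlternating {n k} (φ : Rows n k → Carrier) : Set (c ⊔ ℓ) where
    field
      isMultilinear : IsMultilinear φ
      alternating   : ∀ M {i j} → i ≢ j → (∀ t → M i t ≈ M j t) → φ M ≈ 0#
    open IsMultilinear isMultilinear public

    add-multiple : ∀ M {i r} → i ≢ r → ∀ a (y : Row k) → φ (M [ r ]≔ (λ t → a * M i t + y t)) ≈ φ (M [ r ]≔ y)
    add-multiple M {i} {r} i≢r a y = begin
      φ (M [ r ]≔ (λ t → a * M i t + y t))          ≈⟨ linear M r a (M i) y ⟩
      a * φ (M [ r ]≔ M i) + φ (M [ r ]≔ y)         ≈⟨ +-congʳ (*-congˡ (alternating (M [ r ]≔ M i) i≢r rows-equal)) ⟩
      a * 0# + φ (M [ r ]≔ y)                       ≈⟨ trans (+-congʳ (zeroʳ a)) (+-identityˡ _) ⟩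
      φ (M [ r ]≔ y)                                ∎
      where
      rows-equal : ∀ t → (M [ r ]≔ M i) i t ≈ (M [ r ]≔ M i) r t
      rows-equal t = ≡⇒≈ (P.cong (λ row → row t) (P.trans ([]≔-minimal M r (M i) i≢r) (P.sym ([]≔-updates M r (M i)))))

  ∷-isAlternating : ∀ {m k} {φ : Rows (suc m) k → Carrier} → IsAlternating φ → ∀ x → IsAlternating (λ R → φ (x ∷ R))
  ∷-isAlternating {φ = φ} alt x = record
    { isMultilinear = record
      { cong   = λ R≋S → cong (λ { zero j → refl ; (suc i) j → R≋S i j })
      ; linear = λ R r a u v → trans (cong (∷-[]≔ x R r _))
                   (trans (linear (x ∷ R) (suc r) a u v)
                          (+-cong (*-congˡ (sym (cong (∷-[]≔ x R r u)))) (sym (cong (∷-[]≔ x R r v)))))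
      }
    ; alternating = λ R i≢j Rᵢ≈Rⱼ → alternating (x ∷ R) (i≢j ∘ suc-injective) Rᵢ≈Rⱼ
    }
    where open IsAlternating alt

  map-isAlternating : ∀ {n m k} {φ : Rows n k → Carrier} → IsAlternating φ → (h : Row m → Row k) →
                      (∀ {u v} → (∀ t → u t ≈ v t) → ∀ t → h u t ≈ h v t) →
                      (∀ a u v t → h (λ s → a * u s + v s) t ≈ a * h u t + h v t) →
                      IsAlternating (λ R → φ (h ∘ R))
  map-isAlternating {φ = φ} alt h h-cong h-linear = record
    { isMultilinear = record
      { cong   = λ R≋S → cong (λ i → h-cong (R≋S i))
      ; linear = λ R r a u v → begin
          φ (h ∘ (R [ r ]≔ (λ j → a * u j + v j)))        ≈⟨ cong (map-h R r _) ⟩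
          φ ((h ∘ R) [ r ]≔ h (λ j → a * u j + v j))      ≈⟨ cong ([]≔-congʳ (h ∘ R) r (h-linear a u v)) ⟩
          φ ((h ∘ R) [ r ]≔ (λ t → a * h u t + h v t))    ≈⟨ linear (h ∘ R) r a (h u) (h v) ⟩
          a * φ ((h ∘ R) [ r ]≔ h u) + φ ((h ∘ R) [ r ]≔ h v)
                                                          ≈⟨ +-cong (*-congˡ (cong (map-h R r u))) (cong (map-h R r v)) ⟨
          a * φ (h ∘ (R [ r ]≔ u)) + φ (h ∘ (R [ r ]≔ v)) ∎
      }
    ; alternating = λ R i≢j Rᵢ≈Rⱼ → alternating (h ∘ R) i≢j (h-cong Rᵢ≈Rⱼ)
    }
    where
    open IsAlternating alt
    map-h : ∀ R r w → (h ∘ (R [ r ]≔ w)) ≋ ((h ∘ R) [ r ]≔ h w)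
    map-h R r w i t = ≡⇒≈ (P.cong (λ row → row t) (map-[]≔ h R r w i))

  -- Moving row i to the front takes i adjacent transpositions.
  moveToFront : ∀ {m k} {φ : Rows (suc m) k → Carrier} → IsAlternating φ →
                ∀ i M → φ (M i ∷ removeAt M i) ≈ sgn (toℕ i) * φ M
  moveToFront {φ = φ} alt zero M = trans (cong (λ { zero j → refl ; (suc r) j → refl })) (sym (*-identityˡ _))
    where open IsAlternating alt
  moveToFront {suc m} {φ = φ} alt (suc i) M = begin
    φ (M (suc i) ∷ removeAt M (suc i))           ≈⟨ cong as-swap ⟩
    φ (swap₀₁ (M zero ∷ (M' i ∷ removeAt M' i))) ≈⟨ swap₀₁-antisym isMultilinear (λ N → alternating N (λ ())) _ ⟩
    - φ (M zero ∷ (M' i ∷ removeAt M' i))        ≈⟨ -‿cong (moveToFront (∷-isAlternating alt (M zero)) i M') ⟩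
    - (sgn (toℕ i) * φ (M zero ∷ M'))            ≈⟨ -‿cong (*-congˡ (cong (λ { zero j → refl ; (suc r) j → refl }))) ⟩
    - (sgn (toℕ i) * φ M)                        ≈⟨ -‿distribˡ-* _ _ ⟩
    (- sgn (toℕ i)) * φ M                        ∎
    where
    open IsAlternating alt
    M' = M ∘ suc
    as-swap : (M (suc i) ∷ removeAt M (suc i)) ≋ swap₀₁ (M zero ∷ (M' i ∷ removeAt M' i))
    as-swap zero          j = refl
    as-swap (suc zero)    j = refl
    as-swap (suc (suc r)) j = refl

  minor : ∀ {n} → Fin (suc n) → Fin (suc n) → Matrix (suc n) → Matrix n
  minor i j M r s = M (punchIn i r) (punchIn j s)

  det-cong : ∀ {n} {M N : Matrix n} → M ≋ N → det M ≈ det N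
  det-cong {zero}  M≋N = refl
  det-cong {suc n} {M} {N} M≋N = Σ-cong term
    where
    term : ∀ j → sgn (toℕ j) * (M zero j * det (minor zero j M)) ≈ sgn (toℕ j) * (N zero j * det (minor zero j N))
    term j = *-congˡ (*-cong (M≋N zero j) (det-cong (λ r s → M≋N (suc r) (punchIn j s))))

  scale-linear : ∀ s a x y → s * (a * x + y) ≈ a * (s * x) + s * y
  scale-linear s a x y = trans (distribˡ s (a * x) y) (+-congʳ (x∙yz≈y∙xz s a x))

  Σ-linear : ∀ {n} a {f} (g h : Fin n → Carrier) → (∀ j → f j ≈ a * g j + h j) → Σ f ≈ a * Σ g + Σ h
  Σ-linear a g h f≈ag+h =
    trans (Σ-cong f≈ag+h) (trans (Σ-distrib-+ (λ j → a * g j) h) (+-congʳ (sym (*-distribˡ-Σ a g))))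

  det-linear : ∀ {n} (M : Matrix n) r a (u v : Row n) →
               det (M [ r ]≔ (λ j → a * u j + v j)) ≈ a * det (M [ r ]≔ u) + det (M [ r ]≔ v)
  det-linear {suc n} M zero a u v =
    Σ-linear a (λ j → sgn (toℕ j) * (u j * D j)) (λ j → sgn (toℕ j) * (v j * D j)) term
    where
    D : Fin (suc n) → Carrier
    D j = det (minor zero j M)
    term : ∀ j → sgn (toℕ j) * ((a * u j + v j) * D j) ≈ a * (sgn (toℕ j) * (u j * D j)) + sgn (toℕ j) * (v j * D j)
    term j = trans (*-congˡ (trans (distribʳ (D j) (a * u j) (v j)) (+-congʳ (*-assoc a (u j) (D j)))))
                   (scale-linear (sgn (toℕ j)) a (u j * D j) (v j * D j))
  det-linear {suc n} M (suc r) a u v =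
    trans (Σ-linear a (λ j → sgn (toℕ j) * (M zero j * X u j)) (λ j → sgn (toℕ j) * (M zero j * X v j)) term)
          (sym (+-cong (*-congˡ (Σ-cong (in-minor u))) (Σ-cong (in-minor v))))
    where
    X : Row (suc n) → Fin (suc n) → Carrier
    X z j = det (minor zero j M [ r ]≔ (z ∘ punchIn j))
    minor-[]≔ : ∀ z j → det (minor zero j (M [ suc r ]≔ z)) ≈ X z j
    minor-[]≔ z j = det-cong (λ r' s → ≡⇒≈ (P.cong (λ row → row s)
                      (map-[]≔ (λ row s → row (punchIn j s)) (M ∘ suc) r z r')))
    in-minor : ∀ z j → sgn (toℕ j) * (M zero j * det (minor zero j (M [ suc r ]≔ z))) ≈ sgn (toℕ j) * (M zero j * X z j)
    in-minor z j = *-congˡ (*-congˡ (minor-[]≔ z j))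
    term : ∀ j → sgn (toℕ j) * (M zero j * det (minor zero j (M [ suc r ]≔ (λ j → a * u j + v j))))
                 ≈ a * (sgn (toℕ j) * (M zero j * X u j)) + sgn (toℕ j) * (M zero j * X v j)
    term j = begin
      sgn (toℕ j) * (M zero j * det (minor zero j (M [ suc r ]≔ (λ j → a * u j + v j))))
        ≈⟨ *-congˡ (*-congˡ (trans (minor-[]≔ _ j) (det-linear (minor zero j M) r a (u ∘ punchIn j) (v ∘ punchIn j)))) ⟩
      sgn (toℕ j) * (M zero j * (a * X u j + X v j))
        ≈⟨ *-congˡ (scale-linear (M zero j) a (X u j) (X v j)) ⟩
      sgn (toℕ j) * (a * (M zero j * X u j) + M zero j * X v j)
        ≈⟨ scale-linear (sgn (toℕ j)) a _ _ ⟩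
      a * (sgn (toℕ j) * (M zero j * X u j)) + sgn (toℕ j) * (M zero j * X v j) ∎

  -- Expanding along two rows that are both equal to x; Φ σ stands for the minor of the remaining rows on the columns σ.
  doubleExpansion : ∀ {n} → Row (suc (suc n)) → ((Fin n → Fin (suc (suc n))) → Carrier) → Carrier
  doubleExpansion x Φ =
    Σ (λ j → sgn (toℕ j) * (x j * Σ (λ k → sgn (toℕ k) * (x (punchIn j k) * Φ (punchIn j ∘ punchIn k)))))

  -- The terms of doubleExpansion in which neither expansion used column 0.
  tailExpansion : ∀ {n} → Row (suc (suc n)) → ((Fin n → Fin (suc (suc n))) → Carrier) → Carrier
  tailExpansion x Φ =
    Σ (λ j → sgn (toℕ j) * (x (suc j) * Σ (λ k → sgn (toℕ k) * (x (suc (punchIn j k)) * Φ (punchIn (suc j) ∘ punchIn (suc k))))))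

  -x*-y≈x*y : ∀ x y → (- x) * (- y) ≈ x * y
  -x*-y≈x*y x y = trans (sym (-‿distribˡ-* x (- y))) (trans (-‿cong (sym (-‿distribʳ-* x y))) (⁻¹-involutive _))

  -- The term using column 0 first and column j + 1 second cancels the one using them in the opposite order.
  doubleExpansion≈tailExpansion : ∀ {n} (x : Row (suc (suc n))) Φ → doubleExpansion x Φ ≈ tailExpansion x Φ
  doubleExpansion≈tailExpansion {n} x Φ = begin
    1# * (x zero * Σ B) + Σ (λ j → (- sgn (toℕ j)) * (x (suc j) * (1# * (x zero * Φ (suc ∘ punchIn j)) + L⁻ j)))
      ≈⟨ +-cong (*-identityˡ _) (Σ-linear (- x zero) B L corner) ⟩
    x zero * Σ B + ((- x zero) * Σ B + Σ L)     ≈⟨ +-assoc _ _ _ ⟨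
    (x zero * Σ B + (- x zero) * Σ B) + Σ L     ≈⟨ +-congʳ (trans (sym (distribʳ (Σ B) _ _)) (*-congʳ (-‿inverseʳ (x zero)))) ⟩
    0# * Σ B + Σ L                              ≈⟨ trans (+-congʳ (zeroˡ (Σ B))) (+-identityˡ (Σ L)) ⟩
    Σ L                                         ∎
    where
    e : Fin (suc n) → Fin n → Carrier
    e j k = x (suc (punchIn j k)) * Φ (punchIn (suc j) ∘ punchIn (suc k))
    B L L⁻ : Fin (suc n) → Carrier
    B j = sgn (toℕ j) * (x (suc j) * Φ (suc ∘ punchIn j))
    L j = sgn (toℕ j) * (x (suc j) * Σ (λ k → sgn (toℕ k) * e j k))
    L⁻ j = Σ (λ k → (- sgn (toℕ k)) * e j k)
    L⁻≈-L : ∀ j → L⁻ j ≈ - Σ (λ k → sgn (toℕ k) * e j k)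
    L⁻≈-L j = trans (Σ-cong {f = λ k → (- sgn (toℕ k)) * e j k} (λ k → sym (-‿distribˡ-* _ _)))
                    (sym (-‿distrib-Σ (λ k → sgn (toℕ k) * e j k)))
    corner : ∀ j → (- sgn (toℕ j)) * (x (suc j) * (1# * (x zero * Φ (suc ∘ punchIn j)) + L⁻ j)) ≈ (- x zero) * B j + L j
    corner j = begin
      (- s) * (y * (1# * (x zero * b) + L⁻ j))         ≈⟨ *-congˡ (*-congˡ (+-cong (*-identityˡ _) (L⁻≈-L j))) ⟩
      (- s) * (y * (x zero * b + - l))                  ≈⟨ *-congˡ (scale-linear y (x zero) b (- l)) ⟩
      (- s) * (x zero * (y * b) + y * - l)              ≈⟨ distribˡ (- s) _ _ ⟩
      (- s) * (x zero * (y * b)) + (- s) * (y * - l)    ≈⟨ +-cong first second ⟩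
      (- x zero) * (s * (y * b)) + s * (y * l)          ∎
      where
      s = sgn (toℕ j)
      y = x (suc j)
      b = Φ (suc ∘ punchIn j)
      l = Σ (λ k → sgn (toℕ k) * e j k)
      first : (- s) * (x zero * (y * b)) ≈ (- x zero) * (s * (y * b))
      first = begin
        (- s) * (x zero * (y * b))   ≈⟨ -‿distribˡ-* s _ ⟨
        - (s * (x zero * (y * b)))   ≈⟨ -‿cong (x∙yz≈y∙xz s (x zero) (y * b)) ⟩
        - (x zero * (s * (y * b)))   ≈⟨ -‿distribˡ-* (x zero) _ ⟩
        (- x zero) * (s * (y * b))   ∎
      second : (- s) * (y * - l) ≈ s * (y * l)
      second = trans (*-congˡ (sym (-‿distribʳ-* y l))) (-x*-y≈x*y s (y * l))

  doubleExpansion-vanishes : ∀ {n} (x : Row (suc (suc n))) Φ →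
                             (∀ {σ τ} → (∀ s → σ s ≡ τ s) → Φ σ ≈ Φ τ) → doubleExpansion x Φ ≈ 0#
  doubleExpansion-vanishes {zero} x Φ Φ-cong =
    trans (doubleExpansion≈tailExpansion x Φ) (Σ-zero {f = λ j → sgn (toℕ j) * (x (suc j) * 0#)} vanish)
    where
    vanish : ∀ j → sgn (toℕ j) * (x (suc j) * 0#) ≈ 0#
    vanish j = trans (*-congˡ (zeroʳ (x (suc j)))) (zeroʳ _)
  doubleExpansion-vanishes {suc n} x Φ Φ-cong = begin
    doubleExpansion x Φ                            ≈⟨ doubleExpansion≈tailExpansion x Φ ⟩
    tailExpansion x Φ                              ≈⟨ Σ-cong {f = T} outer ⟩
    doubleExpansion (x ∘ suc) (Φ ∘ lift 1)         ≈⟨ doubleExpansion-vanishes (x ∘ suc) (Φ ∘ lift 1) (λ eq → Φ-cong (lift-cong eq)) ⟩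
    0#                                             ∎
    where
    lift-cong : ∀ {σ τ : Fin n → Fin (suc (suc n))} → (∀ s → σ s ≡ τ s) → ∀ s → lift 1 σ s ≡ lift 1 τ s
    lift-cong eq zero    = P.refl
    lift-cong eq (suc s) = P.cong suc (eq s)
    punchIn-suc : ∀ j k s → punchIn (suc j) (punchIn (suc k) s) ≡ lift 1 (punchIn j ∘ punchIn k) s
    punchIn-suc j k zero    = P.refl
    punchIn-suc j k (suc s) = P.refl
    T : Fin (suc (suc n)) → Carrier
    T j = sgn (toℕ j) * (x (suc j) * Σ (λ k → sgn (toℕ k) * (x (suc (punchIn j k)) * Φ (punchIn (suc j) ∘ punchIn (suc k)))))
    inner : ∀ j k → sgn (toℕ k) * (x (suc (punchIn j k)) * Φ (punchIn (suc j) ∘ punchIn (suc k)))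
                    ≈ sgn (toℕ k) * (x (suc (punchIn j k)) * Φ (lift 1 (punchIn j ∘ punchIn k)))
    inner j k = *-congˡ (*-congˡ (Φ-cong (punchIn-suc j k)))
    outer : ∀ j → T j ≈ sgn (toℕ j) * (x (suc j) * Σ (λ k → sgn (toℕ k) * (x (suc (punchIn j k)) * Φ (lift 1 (punchIn j ∘ punchIn k)))))
    outer j = *-congˡ (*-congˡ (Σ-cong (inner j)))

  det-isMultilinear : ∀ {n} → IsMultilinear (det {n})
  det-isMultilinear = record { cong = det-cong ; linear = det-linear }

  det-alternating₀₁ : ∀ {n} (M : Matrix (suc (suc n))) → (∀ t → M zero t ≈ M (suc zero) t) → det M ≈ 0#
  det-alternating₀₁ {n} M M₀≈M₁ =
    trans (Σ-cong row₁≈row₀) (doubleExpansion-vanishes (M zero) Φ (λ eq → det-cong (λ r s → ≡⇒≈ (P.cong (M (suc (suc r))) (eq s)))))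
    where
    Φ : (Fin n → Fin (suc (suc n))) → Carrier
    Φ σ = det (λ r s → M (suc (suc r)) (σ s))
    expansion : Row (suc (suc n)) → Fin (suc (suc n)) → Carrier
    expansion y j = sgn (toℕ j) * (M zero j * Σ (λ k → sgn (toℕ k) * (y (punchIn j k) * Φ (punchIn j ∘ punchIn k))))
    row₁≈row₀ : ∀ j → expansion (M (suc zero)) j ≈ expansion (M zero) j
    row₁≈row₀ j = *-congˡ (*-congˡ (Σ-cong {f = λ k → sgn (toℕ k) * (M (suc zero) (punchIn j k) * Φ (punchIn j ∘ punchIn k))}
                                          (λ k → *-congˡ (*-congʳ (sym (M₀≈M₁ (punchIn j k)))))))

  det-swap₀₁ : ∀ {n} (M : Matrix (suc (suc n))) → det (swap₀₁ M) ≈ - det M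
  det-swap₀₁ = swap₀₁-antisym det-isMultilinear det-alternating₀₁

  minors≈0⇒det≈0 : ∀ {n} (M : Matrix (suc n)) → (∀ j → det (minor zero j M) ≈ 0#) → det M ≈ 0#
  minors≈0⇒det≈0 M minors≈0 = Σ-zero {f = λ j → sgn (toℕ j) * (M zero j * det (minor zero j M))} term≈0
    where
    term≈0 : ∀ j → sgn (toℕ j) * (M zero j * det (minor zero j M)) ≈ 0#
    term≈0 j = trans (*-congˡ (trans (*-congˡ (minors≈0 j)) (zeroʳ _))) (zeroʳ _)

  det-alternating₀ : ∀ {n} (M : Matrix (suc n)) k → (∀ t → M zero t ≈ M (suc k) t) → det M ≈ 0#
  det-alternating₀ M zero M₀≈Mₖ = det-alternating₀₁ M M₀≈Mₖ
  det-alternating₀ {suc n} M (suc k) M₀≈Mₖ = begin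
    det M             ≈⟨ ⁻¹-involutive (det M) ⟨
    - (- det M)       ≈⟨ -‿cong (det-swap₀₁ M) ⟨
    - det (swap₀₁ M)  ≈⟨ -‿cong (minors≈0⇒det≈0 (swap₀₁ M) (λ j → det-alternating₀ (minor zero j (swap₀₁ M)) k (M₀≈Mₖ ∘ punchIn j))) ⟩
    - 0#              ≈⟨ ε⁻¹≈ε ⟩
    0#                ∎

  det-alternating-punchIn : ∀ {n} (M : Matrix (suc n)) i k → (∀ t → M i t ≈ M (punchIn i k) t) → det M ≈ 0#
  det-alternating-punchIn M zero k Mᵢ≈Mₖ = det-alternating₀ M k Mᵢ≈Mₖ
  det-alternating-punchIn {suc n} M (suc i) zero Mᵢ≈Mₖ = det-alternating₀ M i (sym ∘ Mᵢ≈Mₖ)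
  det-alternating-punchIn {suc n} M (suc i) (suc k) Mᵢ≈Mₖ =
    minors≈0⇒det≈0 M (λ j → det-alternating-punchIn (minor zero j M) i k (Mᵢ≈Mₖ ∘ punchIn j))

  det-alternating : ∀ {n} (M : Matrix n) {i j} → i ≢ j → (∀ t → M i t ≈ M j t) → det M ≈ 0#
  det-alternating {suc n} M {i} {j} i≢j Mᵢ≈Mⱼ = det-alternating-punchIn M i (punchOut i≢j)
    (λ t → trans (Mᵢ≈Mⱼ t) (≡⇒≈ (P.cong (λ r → M r t) (P.sym (punchIn-punchOut i≢j)))))

  det-isAlternating : ∀ {n} → IsAlternating (det {n})
  det-isAlternating = record { isMultilinear = det-isMultilinear ; alternating = det-alternating }

  -- Alternating multilinear functions are multiples of the determinant

  rowwise-invariance : ∀ {n k r} (φ : Rows n k → Carrier) (_∼[_]_ : Row k → Fin n → Row k → Set r) →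
                       (∀ {M N} → M ≋ N → φ M ≈ φ N) →
                       (∀ K i {x y} → x ∼[ i ] y → φ (K [ i ]≔ x) ≈ φ (K [ i ]≔ y)) →
                       ∀ M N → (∀ i → M i ∼[ i ] N i) → φ M ≈ φ N
  rowwise-invariance {zero} φ _∼[_]_ φ-cong replace M N M∼N = φ-cong (λ ())
  rowwise-invariance {suc n} {k} φ _∼[_]_ φ-cong replace M N M∼N = begin
    φ M                           ≈⟨ φ-cong ([]≔-id M zero) ⟨
    φ (M [ zero ]≔ M zero)        ≈⟨ replace M zero (M∼N zero) ⟩
    φ (M [ zero ]≔ N zero)        ≈⟨ φ-cong (λ { zero j → refl ; (suc i) j → refl }) ⟩
    φ (N zero ∷ (M ∘ suc))        ≈⟨ rowwise-invariance (λ R → φ (N zero ∷ R)) (λ x i y → x ∼[ suc i ] y)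
                                       (λ R≋S → φ-cong (λ { zero j → refl ; (suc i) j → R≋S i j }))
                                       replace-tail (M ∘ suc) (N ∘ suc) (M∼N ∘ suc) ⟩
    φ (N zero ∷ (N ∘ suc))        ≈⟨ φ-cong (λ { zero j → refl ; (suc i) j → refl }) ⟩
    φ N                           ∎
    where
    replace-tail : ∀ (K : Rows n k) i {x y} → x ∼[ suc i ] y → φ (N zero ∷ (K [ i ]≔ x)) ≈ φ (N zero ∷ (K [ i ]≔ y))
    replace-tail K i x∼y = trans (φ-cong (∷-[]≔ (N zero) K i _))
                             (trans (replace (N zero ∷ K) (suc i) x∼y) (sym (φ-cong (∷-[]≔ (N zero) K i _))))

  ≡∨punchIn : ∀ {m} (j t : Fin (suc m)) → t ≡ j ⊎ Σ[ s ∈ Fin m ] t ≡ punchIn j s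
  ≡∨punchIn j t with t ≟ j
  ... | yes t≡j = inj₁ t≡j
  ... | no t≢j  = inj₂ (punchOut (t≢j ∘ P.sym) , P.sym (punchIn-punchOut (t≢j ∘ P.sym)))

  clearAt : ∀ {m} → Fin (suc m) → Row (suc m) → Row (suc m)
  clearAt j x = insertAt (x ∘ punchIn j) j 0#

  insertAt-cong : ∀ {m} j {u v : Row m} → (∀ s → u s ≈ v s) → ∀ t → insertAt u j 0# t ≈ insertAt v j 0# t
  insertAt-cong j {u} {v} u≈v t with ≡∨punchIn j t
  ... | inj₁ P.refl rewrite insertAt-lookup u t 0# | insertAt-lookup v t 0# = refl
  ... | inj₂ (s , P.refl) rewrite insertAt-punchIn u j 0# s | insertAt-punchIn v j 0# s = u≈v s

  insertAt-linear : ∀ {m} j a (u v : Row m) t → insertAt (λ s → a * u s + v s) j 0# t ≈ a * insertAt u j 0# t + insertAt v j 0# t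
  insertAt-linear j a u v t with ≡∨punchIn j t
  ... | inj₁ P.refl rewrite insertAt-lookup (λ s → a * u s + v s) t 0# | insertAt-lookup u t 0# | insertAt-lookup v t 0# =
    sym (trans (+-congʳ (zeroʳ a)) (+-identityˡ 0#))
  ... | inj₂ (s , P.refl) rewrite insertAt-punchIn (λ s → a * u s + v s) j 0# s | insertAt-punchIn u j 0# s
                                | insertAt-punchIn v j 0# s = refl

  clearAt+δ : ∀ {m} j (x : Row (suc m)) t → x t ≈ clearAt j x t + x j * δ j t
  clearAt+δ j x t with ≡∨punchIn j t
  ... | inj₁ P.refl rewrite insertAt-lookup (x ∘ punchIn t) t 0# =
    sym (trans (+-identityˡ _) (trans (*-congˡ (δ-refl t)) (*-identityʳ _)))
  ... | inj₂ (s , P.refl) rewrite insertAt-punchIn (x ∘ punchIn j) j 0# s =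
    sym (trans (+-congˡ (trans (*-congˡ (δ-≢ (punchInᵢ≢i j s ∘ P.sym))) (zeroʳ _))) (+-identityʳ _))

  insertAt-δ : ∀ {m} j (r : Fin m) t → insertAt (δ r) j 0# t ≈ δ (punchIn j r) t
  insertAt-δ j r t with ≡∨punchIn j t
  ... | inj₁ P.refl rewrite insertAt-lookup (δ r) t 0# = sym (δ-≢ (punchInᵢ≢i t r))
  ... | inj₂ (s , P.refl) rewrite insertAt-punchIn (δ r) j 0# s = sym (δ-punchIn j r s)

  clear-below-unitRow : ∀ {m k} {φ : Rows (suc m) (suc k) → Carrier} → IsAlternating φ →
                        ∀ j (R : Rows m (suc k)) → φ (δ j ∷ R) ≈ φ (δ j ∷ (clearAt j ∘ R))
  clear-below-unitRow {m} {k} {φ} alt j R =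
    rowwise-invariance (λ R → φ (δ j ∷ R)) (λ x _ y → Σ[ a ∈ Carrier ] (∀ t → x t ≈ a * δ j t + y t))
      (λ R≋S → cong (λ { zero t → refl ; (suc i) t → R≋S i t })) replace R (clearAt j ∘ R)
      (λ r → R r j , λ t → trans (clearAt+δ j (R r) t) (+-comm _ _))
    where
    open IsAlternating alt
    replace : ∀ K i {x y} → Σ[ a ∈ Carrier ] (∀ t → x t ≈ a * δ j t + y t) → φ (δ j ∷ (K [ i ]≔ x)) ≈ φ (δ j ∷ (K [ i ]≔ y))
    replace K i {x} {y} (a , x≈aδ+y) = begin
      φ (δ j ∷ (K [ i ]≔ x))                               ≈⟨ cong (∷-[]≔ (δ j) K i x) ⟩
      φ ((δ j ∷ K) [ suc i ]≔ x)                           ≈⟨ cong ([]≔-congʳ (δ j ∷ K) (suc i) x≈aδ+y) ⟩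
      φ ((δ j ∷ K) [ suc i ]≔ (λ t → a * δ j t + y t))     ≈⟨ add-multiple (δ j ∷ K) {zero} {suc i} (λ ()) a y ⟩
      φ ((δ j ∷ K) [ suc i ]≔ y)                           ≈⟨ cong (∷-[]≔ (δ j) K i y) ⟨
      φ (δ j ∷ (K [ i ]≔ y))                               ∎

  alternating⇒≈det*φI : ∀ {n} {φ : Matrix n → Carrier} → IsAlternating φ → ∀ M → φ M ≈ det M * φ Iᴹ
  alternating⇒≈det*φI {zero} alt M = trans (IsAlternating.cong alt (λ ())) (sym (*-identityˡ _))
  alternating⇒≈det*φI {suc m} {φ} alt M = begin
    φ M                                                      ≈⟨ cong row₀-in-basis ⟩
    φ (M [ zero ]≔ (λ t → Σ (λ j → M zero j * δ j t)))       ≈⟨ linear-Σ M zero (M zero) δ ⟩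
    Σ (λ j → M zero j * φ (M [ zero ]≔ δ j))                 ≈⟨ Σ-cong term ⟩
    Σ (λ j → sgn (toℕ j) * (M zero j * D j) * φ Iᴹ)          ≈⟨ *-distribʳ-Σ (φ Iᴹ) (λ j → sgn (toℕ j) * (M zero j * D j)) ⟨
    det M * φ Iᴹ                                             ∎
    where
    open IsAlternating alt
    D : Fin (suc m) → Carrier
    D j = det (minor zero j M)
    row₀-in-basis : M ≋ (M [ zero ]≔ (λ t → Σ (λ j → M zero j * δ j t)))
    row₀-in-basis zero    t = sym (Σ-*δ (M zero) t)
    row₀-in-basis (suc i) t = refl
    unitRow : ∀ j → φ (M [ zero ]≔ δ j) ≈ D j * (sgn (toℕ j) * φ Iᴹ)
    unitRow j = begin
      φ (M [ zero ]≔ δ j)                                  ≈⟨ cong (λ { zero t → refl ; (suc i) t → refl }) ⟩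
      φ (δ j ∷ (M ∘ suc))                                  ≈⟨ clear-below-unitRow alt j (M ∘ suc) ⟩
      ψ (minor zero j M)                                   ≈⟨ alternating⇒≈det*φI ψ-isAlternating (minor zero j M) ⟩
      D j * ψ Iᴹ                                           ≈⟨ *-congˡ (cong (λ { zero t → refl ; (suc r) t → insertAt-δ j r t })) ⟩
      D j * φ (Iᴹ j ∷ removeAt Iᴹ j)                       ≈⟨ *-congˡ (moveToFront alt j Iᴹ) ⟩
      D j * (sgn (toℕ j) * φ Iᴹ)                           ∎
      where
      ψ : Matrix m → Carrier
      ψ R = φ (δ j ∷ (λ r → insertAt (R r) j 0#))
      ψ-isAlternating : IsAlternating ψ
      ψ-isAlternating = map-isAlternating (∷-isAlternating alt (δ j)) (λ u → insertAt u j 0#) (insertAt-cong j) (insertAt-linear j)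
    term : ∀ j → M zero j * φ (M [ zero ]≔ δ j) ≈ sgn (toℕ j) * (M zero j * D j) * φ Iᴹ
    term j = begin
      M zero j * φ (M [ zero ]≔ δ j)                ≈⟨ *-congˡ (unitRow j) ⟩
      M zero j * (D j * (sgn (toℕ j) * φ Iᴹ))       ≈⟨ *-congˡ (x∙yz≈y∙xz (D j) _ _) ⟩
      M zero j * (sgn (toℕ j) * (D j * φ Iᴹ))       ≈⟨ x∙yz≈y∙xz (M zero j) _ _ ⟩
      sgn (toℕ j) * (M zero j * (D j * φ Iᴹ))       ≈⟨ *-congˡ (*-assoc _ _ _) ⟨
      sgn (toℕ j) * (M zero j * D j * φ Iᴹ)         ≈⟨ *-assoc _ _ _ ⟨
      sgn (toℕ j) * (M zero j * D j) * φ Iᴹ         ∎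

  det-Iᴹ : ∀ {n} → det (Iᴹ {n}) ≈ 1#
  det-Iᴹ {zero}  = refl
  det-Iᴹ {suc n} = begin
    1# * (1# * det (Iᴹ {n})) + Σ off-diagonal  ≈⟨ +-cong (trans (*-identityˡ _) (trans (*-identityˡ _) (det-Iᴹ {n})))
                                                          (Σ-zero {f = off-diagonal} (λ j → trans (*-congˡ (zeroˡ _)) (zeroʳ _))) ⟩
    1# + 0#                                    ≈⟨ +-identityʳ 1# ⟩
    1#                                         ∎
    where
    off-diagonal : Fin n → Carrier
    off-diagonal j = sgn (toℕ (suc j)) * (0# * det (minor zero (suc j) Iᴹ))

  det-*ᴹ : ∀ {n} (X Y : Matrix n) → det (X *ᴹ Y) ≈ det X * det Y
  det-*ᴹ {n} X Y =
    trans (alternating⇒≈det*φI (map-isAlternating det-isAlternating times-Y times-Y-cong times-Y-linear) X)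
          (*-congˡ (det-cong (λ i t → Σ-δ* (λ k → Y k t) i)))
    where
    times-Y : Row n → Row n
    times-Y u t = Σ (λ k → u k * Y k t)
    times-Y-cong : ∀ {u v : Row n} → (∀ t → u t ≈ v t) → ∀ t → times-Y u t ≈ times-Y v t
    times-Y-cong u≈v t = Σ-cong (λ k → *-congʳ (u≈v k))
    times-Y-linear : ∀ a (u v : Row n) t → times-Y (λ s → a * u s + v s) t ≈ a * times-Y u t + times-Y v t
    times-Y-linear a u v t = Σ-linear a (λ k → u k * Y k t) (λ k → v k * Y k t)
                               (λ k → trans (distribʳ _ _ _) (+-congʳ (*-assoc _ _ _)))

  -- Laplace expansion, adjugate and inverses

  det-expansion : ∀ {n} (M : Matrix (suc n)) i → det M ≈ sgn (toℕ i) * Σ (λ j → sgn (toℕ j) * (M i j * det (minor i j M)))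
  det-expansion M i = begin
    det M                                ≈⟨ *-identityˡ _ ⟨
    1# * det M                           ≈⟨ *-congʳ (sgn-square (toℕ i)) ⟨
    sgn (toℕ i) * sgn (toℕ i) * det M    ≈⟨ *-assoc _ _ _ ⟩
    sgn (toℕ i) * (sgn (toℕ i) * det M)  ≈⟨ *-congˡ (moveToFront det-isAlternating i M) ⟨
    sgn (toℕ i) * det (M i ∷ removeAt M i) ∎

  adj : ∀ {n} → Matrix n → Matrix n
  adj {zero}  M ()
  adj {suc n} M j i = sgn (toℕ i) * (sgn (toℕ j) * det (minor i j M))

  *ᴹ-adj : ∀ {n} (M : Matrix n) k i → (M *ᴹ adj M) k i ≈ det M * δ k i
  *ᴹ-adj {suc n} M k i = begin
    Σ (λ j → M k j * adj M j i)                                      ≈⟨ Σ-cong term ⟩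
    Σ (λ j → sgn (toℕ i) * (sgn (toℕ j) * (N i j * det (minor i j N)))) ≈⟨ *-distribˡ-Σ (sgn (toℕ i)) (λ j → sgn (toℕ j) * (N i j * det (minor i j N))) ⟨
    sgn (toℕ i) * Σ (λ j → sgn (toℕ j) * (N i j * det (minor i j N)))   ≈⟨ det-expansion N i ⟨
    det N                                                            ≈⟨ det-N ⟩
    det M * δ k i                                                    ∎
    where
    N : Matrix (suc n)
    N = M [ i ]≔ M k
    term : ∀ j → M k j * adj M j i ≈ sgn (toℕ i) * (sgn (toℕ j) * (N i j * det (minor i j N)))
    term j = begin
      M k j * (sgn (toℕ i) * (sgn (toℕ j) * det (minor i j M)))   ≈⟨ x∙yz≈y∙xz _ _ _ ⟩
      sgn (toℕ i) * (M k j * (sgn (toℕ j) * det (minor i j M)))   ≈⟨ *-congˡ (x∙yz≈y∙xz _ _ _) ⟩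
      sgn (toℕ i) * (sgn (toℕ j) * (M k j * det (minor i j M)))   ≈⟨ *-congˡ (*-congˡ (*-cong
                                                                       (≡⇒≈ (P.cong (λ row → row j) ([]≔-updates M i (M k))))
                                                                       (det-cong (λ r s → ≡⇒≈ (P.cong (λ row → row (punchIn j s)) ([]≔-punchIn M i (M k) r)))))) ⟨
      sgn (toℕ i) * (sgn (toℕ j) * (N i j * det (minor i j N)))   ∎
    det-N : det N ≈ det M * δ k i
    det-N with k ≟ i
    ... | yes P.refl = trans (det-cong ([]≔-id M k)) (sym (trans (*-congˡ (δ-refl k)) (*-identityʳ _)))
    ... | no k≢i = trans (det-alternating N (k≢i ∘ P.sym) rows-equal) (sym (trans (*-congˡ (δ-≢ k≢i)) (zeroʳ _)))
      where
      rows-equal : ∀ t → N i t ≈ N k t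
      rows-equal t = ≡⇒≈ (P.cong (λ row → row t) (P.trans ([]≔-updates M i (M k)) (P.sym ([]≔-minimal M i (M k) k≢i))))

  *ᴹ-cong : ∀ {n} {A A' B B' : Matrix n} → A ≈ᴹ A' → B ≈ᴹ B' → (A *ᴹ B) ≈ᴹ (A' *ᴹ B')
  *ᴹ-cong A≈A' B≈B' i j = Σ-cong (λ k → *-cong (A≈A' i k) (B≈B' k j))

  *ᴹ-assoc : ∀ {n} (A B C : Matrix n) → ((A *ᴹ B) *ᴹ C) ≈ᴹ (A *ᴹ (B *ᴹ C))
  *ᴹ-assoc A B C i j = begin
    Σ (λ k → Σ (λ l → A i l * B l k) * C k j)      ≈⟨ Σ-cong (λ k → *-distribʳ-Σ (C k j) (λ l → A i l * B l k)) ⟩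
    Σ (λ k → Σ (λ l → A i l * B l k * C k j))      ≈⟨ Σ-cong (λ k → Σ-cong (λ l → *-assoc (A i l) (B l k) (C k j))) ⟩
    Σ (λ k → Σ (λ l → A i l * (B l k * C k j)))    ≈⟨ Σ-comm (λ k l → A i l * (B l k * C k j)) ⟩
    Σ (λ l → Σ (λ k → A i l * (B l k * C k j)))    ≈⟨ Σ-cong (λ l → *-distribˡ-Σ (A i l) (λ k → B l k * C k j)) ⟨
    Σ (λ l → A i l * Σ (λ k → B l k * C k j))      ∎

  *ᴹ-identityˡ : ∀ {n} (A : Matrix n) → (Iᴹ *ᴹ A) ≈ᴹ A
  *ᴹ-identityˡ A i j = Σ-δ* (λ k → A k j) i

  *ᴹ-identityʳ : ∀ {n} (A : Matrix n) → (A *ᴹ Iᴹ) ≈ᴹ A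
  *ᴹ-identityʳ A i j = Σ-*δ (A i) j

  rightInverse⇒det≉0 : ∀ {n} {M X : Matrix n} → (M *ᴹ X) ≈ᴹ Iᴹ → ¬ (det X ≈ 0#)
  rightInverse⇒det≉0 {n} {M} {X} MX≈I = *≈1⇒≉0 (det M) (det X) (trans (sym (det-*ᴹ M X)) (trans (det-cong MX≈I) (det-Iᴹ {n})))

  det≉0⇒rightInverse : ∀ {n} (M : Matrix n) → ¬ (det M ≈ 0#) → Σ[ X ∈ Matrix n ] (M *ᴹ X) ≈ᴹ Iᴹ
  det≉0⇒rightInverse {n} M detM≉0 = X , MX≈I
    where
    d⁻¹ : Carrier
    d⁻¹ = proj₁ (inverse (det M) detM≉0)
    X : Matrix n
    X j i = d⁻¹ * adj M j i
    MX≈I : (M *ᴹ X) ≈ᴹ Iᴹ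
    MX≈I k i = begin
      Σ (λ j → M k j * (d⁻¹ * adj M j i))   ≈⟨ Σ-cong (λ j → x∙yz≈y∙xz (M k j) d⁻¹ (adj M j i)) ⟩
      Σ (λ j → d⁻¹ * (M k j * adj M j i))   ≈⟨ *-distribˡ-Σ d⁻¹ (λ j → M k j * adj M j i) ⟨
      d⁻¹ * (M *ᴹ adj M) k i                ≈⟨ *-congˡ (*ᴹ-adj M k i) ⟩
      d⁻¹ * (det M * δ k i)                 ≈⟨ *-assoc _ _ _ ⟨
      d⁻¹ * det M * δ k i                   ≈⟨ *-congʳ (trans (*-comm _ _) (proj₂ (inverse (det M) detM≉0))) ⟩
      1# * δ k i                            ≈⟨ *-identityˡ _ ⟩
      δ k i                                 ∎

  -- A right inverse X of M has a right inverse Y of its own, and then M = M (X Y) = (M X) Y = Y.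
  det≉0⇒invertible : ∀ {n} (M : Matrix n) → ¬ (det M ≈ 0#) → Invertible M
  det≉0⇒invertible M detM≉0 = X , MX≈I , ≋-trans (*ᴹ-cong (λ _ _ → refl) M≈Y) XY≈I
    where
    X = proj₁ (det≉0⇒rightInverse M detM≉0)
    MX≈I = proj₂ (det≉0⇒rightInverse M detM≉0)
    Y = proj₁ (det≉0⇒rightInverse X (rightInverse⇒det≉0 MX≈I))
    XY≈I = proj₂ (det≉0⇒rightInverse X (rightInverse⇒det≉0 MX≈I))
    M≈Y : M ≈ᴹ Y
    M≈Y = ≋-trans (≋-sym (*ᴹ-identityʳ M)) (≋-trans (*ᴹ-cong (λ _ _ → refl) (≋-sym XY≈I))
            (≋-trans (≋-sym (*ᴹ-assoc M X Y)) (≋-trans (*ᴹ-cong MX≈I (λ _ _ → refl)) (*ᴹ-identityˡ Y))))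

  -- Principal minors as determinants of full-size matrices

  separates : ∀ {n} (P : Fin n → Bool) {i r} → P i ≡ true → P r ≡ false → i ≢ r
  separates P Pi Pr P.refl with P.trans (P.sym Pi) Pr
  ... | ()

  idOutside : ∀ {n} → (Fin n → Bool) → Matrix n → Matrix n
  idOutside P M i j = if P i then M i j else δ i j

  idOutside-inside : ∀ {n} (P : Fin n → Bool) (M : Matrix n) {i} j → P i ≡ true → idOutside P M i j ≡ M i j
  idOutside-inside P M j Pi rewrite Pi = P.refl

  idOutside-outside : ∀ {n} (P : Fin n → Bool) (M : Matrix n) {i} j → P i ≡ false → idOutside P M i j ≡ δ i j
  idOutside-outside P M j Pi rewrite Pi = P.refl

  idOutside-cong : ∀ {n} (P : Fin n → Bool) {M N : Matrix n} → M ≈ᴹ N → idOutside P M ≈ᴹ idOutside P N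
  idOutside-cong P M≈N i j with P i
  ... | true  = M≈N i j
  ... | false = refl

  idOutside-[]≔-inside : ∀ {n} (P : Fin n → Bool) (K : Matrix n) {r} x → P r ≡ true →
                         idOutside P (K [ r ]≔ x) ≈ᴹ (idOutside P K [ r ]≔ x)
  idOutside-[]≔-inside P K {r} x Pr i j with i ≟ r
  ... | yes P.refl rewrite Pr | []≔-updates K i x | []≔-updates (idOutside P K) i x = refl
  ... | no i≢r rewrite []≔-minimal K r x i≢r | []≔-minimal (idOutside P K) r x i≢r = refl

  idOutside-[]≔-outside : ∀ {n} (P : Fin n → Bool) (K : Matrix n) {r} x → P r ≡ false →
                          idOutside P (K [ r ]≔ x) ≈ᴹ idOutside P K
  idOutside-[]≔-outside P K {r} x Pr i j with P i in Pi
  ... | false = refl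
  ... | true rewrite []≔-minimal K r x (separates P Pi Pr) = refl

  keepColumns : ∀ {n} → (Fin n → Bool) → Matrix n → Matrix n
  keepColumns P M i j = if P j then M i j else 0#

  -- The entries of the rows in P that lie in columns outside P are cleared using the unit rows outside P.
  det-idOutside-keepColumns : ∀ {n} (P : Fin n → Bool) (M : Matrix n) →
                              det (idOutside P M) ≈ det (idOutside P (keepColumns P M))
  det-idOutside-keepColumns {n} P M =
    rowwise-invariance (det ∘ idOutside P) (λ x _ y → ∀ j → P j ≡ true → x j ≈ y j)
      (λ M≈N → det-cong (idOutside-cong P M≈N)) replace M (keepColumns P M) agree
    where
    open IsAlternating det-isAlternating
    agree : ∀ r j → P j ≡ true → M r j ≈ keepColumns P M r j
    agree r j Pj rewrite Pj = refl
    replace : ∀ K r {x y} → (∀ j → P j ≡ true → x j ≈ y j) → det (idOutside P (K [ r ]≔ x)) ≈ det (idOutside P (K [ r ]≔ y))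
    replace K r {x} {y} x≈y with P r in Pr
    ... | false = trans (det-cong (idOutside-[]≔-outside P K x Pr)) (sym (det-cong (idOutside-[]≔-outside P K y Pr)))
    ... | true = begin
      det (idOutside P (K [ r ]≔ x))                                   ≈⟨ det-cong (idOutside-[]≔-inside P K x Pr) ⟩
      det (L [ r ]≔ x)                                                 ≈⟨ det-cong ([]≔-congʳ L r x≈d+y) ⟩
      det (L [ r ]≔ (λ j → Σ (λ c → d c * δ c j) + y j))               ≈⟨ additive L r _ y ⟩
      det (L [ r ]≔ (λ j → Σ (λ c → d c * δ c j))) + det (L [ r ]≔ y)  ≈⟨ +-congʳ (linear-Σ L r d δ) ⟩
      Σ (λ c → d c * det (L [ r ]≔ δ c)) + det (L [ r ]≔ y)            ≈⟨ +-congʳ (Σ-zero term≈0) ⟩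
      0# + det (L [ r ]≔ y)                                            ≈⟨ +-identityˡ _ ⟩
      det (L [ r ]≔ y)                                                 ≈⟨ det-cong (idOutside-[]≔-inside P K y Pr) ⟨
      det (idOutside P (K [ r ]≔ y))                                   ∎
      where
      L : Matrix n
      L = idOutside P K
      d : Row n
      d c = x c - y c
      x≈d+y : ∀ j → x j ≈ Σ (λ c → d c * δ c j) + y j
      x≈d+y j = sym (trans (+-congʳ (Σ-*δ d j)) (x-y+y≈x (x j) (y j)))
      term≈0 : ∀ c → d c * det (L [ r ]≔ δ c) ≈ 0#
      term≈0 c with P c in Pc
      ... | true  = trans (*-congʳ (x≈y⇒x∙y⁻¹≈ε (x≈y c Pc))) (zeroˡ _)
      ... | false = trans (*-congˡ (alternating (L [ r ]≔ δ c) (separates P Pr Pc) rows-equal)) (zeroʳ _)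
        where
        rows-equal : ∀ t → (L [ r ]≔ δ c) r t ≈ (L [ r ]≔ δ c) c t
        rows-equal t = ≡⇒≈ (P.trans (P.cong (λ row → row t) ([]≔-updates L r (δ c)))
                             (P.sym (P.trans (P.cong (λ row → row t) ([]≔-minimal L r (δ c) (separates P Pr Pc ∘ P.sym)))
                                             (idOutside-outside P K t Pc))))

  -- The inverse of elem S, and nothing outside S.
  position : ∀ {n} (S : Subset n) → Fin n → Maybe (Fin (card S))
  position (true  Vec.∷ S) zero    = just zero
  position (false Vec.∷ S) zero    = nothing
  position (true  Vec.∷ S) (suc i) = Maybe.map suc (position S i)
  position (false Vec.∷ S) (suc i) = position S i

  position-elem : ∀ {n} (S : Subset n) t → position S (elem S t) ≡ just t
  position-elem (true  Vec.∷ S) zero    = P.refl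
  position-elem (true  Vec.∷ S) (suc t) = P.cong (Maybe.map suc) (position-elem S t)
  position-elem (false Vec.∷ S) t       = position-elem S t

  position-just : ∀ {n} (S : Subset n) i {t} → position S i ≡ just t → elem S t ≡ i
  position-just (true  Vec.∷ S) zero    P.refl = P.refl
  position-just (true  Vec.∷ S) (suc i) eq with position S i in eq′
  position-just (true  Vec.∷ S) (suc i) P.refl | just t = P.cong suc (position-just S i eq′)
  position-just (false Vec.∷ S) (suc i) eq = P.cong suc (position-just S i eq)

  position-inside : ∀ {n} (S : Subset n) i → lookup S i ≡ true → Σ[ t ∈ Fin (card S) ] position S i ≡ just t
  position-inside (true  Vec.∷ S) zero    _   = zero , P.refl
  position-inside (true  Vec.∷ S) (suc i) Sᵢ with position-inside S i Sᵢ
  ... | t , eq = suc t , P.cong (Maybe.map suc) eq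
  position-inside (false Vec.∷ S) (suc i) Sᵢ = position-inside S i Sᵢ

  position-outside : ∀ {n} (S : Subset n) i → lookup S i ≡ false → position S i ≡ nothing
  position-outside (false Vec.∷ S) zero    _  = P.refl
  position-outside (true  Vec.∷ S) (suc i) Sᵢ = P.cong (Maybe.map suc) (position-outside S i Sᵢ)
  position-outside (false Vec.∷ S) (suc i) Sᵢ = position-outside S i Sᵢ

  lookup-elem : ∀ {n} (S : Subset n) t → lookup S (elem S t) ≡ true
  lookup-elem (true  Vec.∷ S) zero    = P.refl
  lookup-elem (true  Vec.∷ S) (suc t) = lookup-elem S t
  lookup-elem (false Vec.∷ S) t       = lookup-elem S t

  elem-injective : ∀ {n} (S : Subset n) {t t′} → elem S t ≡ elem S t′ → t ≡ t′
  elem-injective S {t} {t′} eq =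
    just-injective (P.trans (P.sym (position-elem S t)) (P.trans (P.cong (position S) eq) (position-elem S t′)))

  δ-elem : ∀ {n} (S : Subset n) t t′ → δ (elem S t) (elem S t′) ≈ δ t t′
  δ-elem S t t′ with t ≟ t′
  ... | yes P.refl = trans (δ-refl (elem S t)) (sym (δ-refl t))
  ... | no t≢t′    = trans (δ-≢ (t≢t′ ∘ elem-injective S)) (sym (δ-≢ t≢t′))

  -- Extension by zeros from the rows and columns in S to all of Fin n.
  embedRow : ∀ {n} (S : Subset n) → Row (card S) → Row n
  embedRow S w j = maybe′ w 0# (position S j)

  embed : ∀ {n} (S : Subset n) → Matrix (card S) → Matrix n
  embed S R i = maybe′ (embedRow S ∘ R) (λ _ → 0#) (position S i)

  embed-inside : ∀ {n} (S : Subset n) R {i j t t′} → position S i ≡ just t → position S j ≡ just t′ → embed S R i j ≡ R t t′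
  embed-inside S R pᵢ pⱼ rewrite pᵢ | pⱼ = P.refl

  embed-outside : ∀ {n} (S : Subset n) R i {j} → position S j ≡ nothing → embed S R i j ≡ 0#
  embed-outside S R i pⱼ with position S i
  ... | nothing = P.refl
  ... | just t rewrite pⱼ = P.refl

  embedRow-cong : ∀ {n} (S : Subset n) {u v : Row (card S)} → (∀ t → u t ≈ v t) → ∀ j → embedRow S u j ≈ embedRow S v j
  embedRow-cong S u≈v j with position S j
  ... | nothing = refl
  ... | just t  = u≈v t

  embedRow-linear : ∀ {n} (S : Subset n) a (u v : Row (card S)) j →
                    embedRow S (λ s → a * u s + v s) j ≈ a * embedRow S u j + embedRow S v j
  embedRow-linear S a u v j with position S j
  ... | nothing = sym (trans (+-congʳ (zeroʳ a)) (+-identityˡ 0#))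
  ... | just t  = refl

  embed-cong : ∀ {n} (S : Subset n) {R R′ : Matrix (card S)} → R ≈ᴹ R′ → embed S R ≈ᴹ embed S R′
  embed-cong S R≈R′ i j with position S i
  ... | nothing = refl
  ... | just t  = embedRow-cong S (R≈R′ t) j

  embed-[]≔ : ∀ {n} (S : Subset n) (R : Matrix (card S)) t w → embed S (R [ t ]≔ w) ≈ᴹ (embed S R [ elem S t ]≔ embedRow S w)
  embed-[]≔ S R t w i j with i ≟ elem S t
  ... | yes P.refl rewrite []≔-updates (embed S R) (elem S t) (embedRow S w) | position-elem S t | []≔-updates R t w = refl
  ... | no i≢t rewrite []≔-minimal (embed S R) (elem S t) (embedRow S w) i≢t with position S i in pᵢ
  ...   | nothing = refl
  ...   | just t′ rewrite []≔-minimal R t w {t′} (λ { P.refl → i≢t (P.sym (position-just S i pᵢ)) }) = refl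

  idOutside-keepColumns≈embed-sub : ∀ {n} (S : Subset n) (M : Matrix n) →
    idOutside (lookup S) (keepColumns (lookup S) M) ≈ᴹ idOutside (lookup S) (embed S (sub M S))
  idOutside-keepColumns≈embed-sub S M i j with lookup S i in Sᵢ
  ... | false = refl
  ... | true with position-inside S i Sᵢ | lookup S j in Sⱼ
  ...   | t , pᵢ | false = sym (≡⇒≈ (embed-outside S (sub M S) i (position-outside S j Sⱼ)))
  ...   | t , pᵢ | true with position-inside S j Sⱼ
  ...     | t′ , pⱼ = sym (≡⇒≈ (P.trans (embed-inside S (sub M S) pᵢ pⱼ)
                                        (P.cong₂ M (position-just S i pᵢ) (position-just S j pⱼ))))

  idOutside-embed-isAlternating : ∀ {n} (S : Subset n) → IsAlternating (λ R → det (idOutside (lookup S) (embed S R)))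
  idOutside-embed-isAlternating {n} S = record
    { isMultilinear = record
      { cong   = λ R≈R′ → det-cong (idOutside-cong (lookup S) (embed-cong S R≈R′))
      ; linear = linear′
      }
    ; alternating = λ R t≢t′ Rₜ≈Rₜ′ → det-alternating _ (t≢t′ ∘ elem-injective S)
                      (λ j → trans (≡⇒≈ (row R _ j)) (trans (embedRow-cong S Rₜ≈Rₜ′ j) (sym (≡⇒≈ (row R _ j)))))
    }
    where
    χ : Matrix (card S) → Carrier
    χ R = det (idOutside (lookup S) (embed S R))
    at-elem : ∀ R t w → idOutside (lookup S) (embed S (R [ t ]≔ w)) ≈ᴹ (idOutside (lookup S) (embed S R) [ elem S t ]≔ embedRow S w)
    at-elem R t w = ≋-trans (idOutside-cong (lookup S) (embed-[]≔ S R t w))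
                            (idOutside-[]≔-inside (lookup S) (embed S R) (embedRow S w) (lookup-elem S t))
    linear′ : ∀ R t a (u v : Row (card S)) → χ (R [ t ]≔ (λ j → a * u j + v j)) ≈ a * χ (R [ t ]≔ u) + χ (R [ t ]≔ v)
    linear′ R t a u v = begin
      χ (R [ t ]≔ (λ j → a * u j + v j))                              ≈⟨ det-cong (at-elem R t _) ⟩
      det (L [ elem S t ]≔ embedRow S (λ j → a * u j + v j))          ≈⟨ det-cong ([]≔-congʳ L (elem S t) (embedRow-linear S a u v)) ⟩
      det (L [ elem S t ]≔ (λ j → a * embedRow S u j + embedRow S v j)) ≈⟨ det-linear L (elem S t) a (embedRow S u) (embedRow S v) ⟩
      a * det (L [ elem S t ]≔ embedRow S u) + det (L [ elem S t ]≔ embedRow S v)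
                                                                      ≈⟨ +-cong (*-congˡ (det-cong (at-elem R t u))) (det-cong (at-elem R t v)) ⟨
      a * χ (R [ t ]≔ u) + χ (R [ t ]≔ v)                             ∎
      where
      L = idOutside (lookup S) (embed S R)
    row : ∀ (R : Matrix (card S)) t j → idOutside (lookup S) (embed S R) (elem S t) j ≡ embedRow S (R t) j
    row R t j rewrite idOutside-inside (lookup S) (embed S R) j (lookup-elem S t) | position-elem S t = P.refl

  idOutside-embed-Iᴹ : ∀ {n} (S : Subset n) → idOutside (lookup S) (embed S Iᴹ) ≈ᴹ Iᴹ
  idOutside-embed-Iᴹ S i j with lookup S i in Sᵢ
  ... | false = refl
  ... | true with position-inside S i Sᵢ | position S j in pⱼ
  ...   | t , pᵢ | nothing = trans (≡⇒≈ (embed-outside S Iᴹ i pⱼ)) (sym (δ-≢ i≢j))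
    where
    i≢j : i ≢ j
    i≢j P.refl with P.trans (P.sym pᵢ) pⱼ
    ... | ()
  ...   | t , pᵢ | just t′ = trans (≡⇒≈ (embed-inside S Iᴹ pᵢ pⱼ))
                             (trans (sym (δ-elem S t t′)) (≡⇒≈ (P.cong₂ δ (position-just S i pᵢ) (position-just S j pⱼ))))

  det-idOutside≈det-sub : ∀ {n} (S : Subset n) (M : Matrix n) → det (idOutside (lookup S) M) ≈ det (sub M S)
  det-idOutside≈det-sub {n} S M = begin
    det (idOutside (lookup S) M)                                 ≈⟨ det-idOutside-keepColumns (lookup S) M ⟩
    det (idOutside (lookup S) (keepColumns (lookup S) M))        ≈⟨ det-cong (idOutside-keepColumns≈embed-sub S M) ⟩
    det (idOutside (lookup S) (embed S (sub M S)))               ≈⟨ alternating⇒≈det*φI (idOutside-embed-isAlternating S) (sub M S) ⟩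
    det (sub M S) * det (idOutside (lookup S) (embed S Iᴹ))      ≈⟨ *-congˡ (trans (det-cong (idOutside-embed-Iᴹ S)) (det-Iᴹ {n})) ⟩
    det (sub M S) * 1#                                           ≈⟨ *-identityʳ _ ⟩
    det (sub M S)                                                ∎

  -- Principal minor equivalence, the empty minor included

  _≈ₘ_ : ∀ {n} → Matrix n → Matrix n → Set ℓ
  M ≈ₘ N = ∀ P → det (idOutside P M) ≈ det (idOutside P N)

  ≈ₘ⇒PME : ∀ {n} {M N : Matrix n} → M ≈ₘ N → PME M N
  ≈ₘ⇒PME {M = M} {N} M≈ₘN S _ = trans (sym (det-idOutside≈det-sub S M)) (trans (M≈ₘN (lookup S)) (det-idOutside≈det-sub S N))

  PME⇒≈ₘ : ∀ {n} {M N : Matrix n} → PME M N → M ≈ₘ N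
  PME⇒≈ₘ {n} {M} {N} pme P with any? (λ i → P i Bool.≟ true)
  ... | yes (i , Pᵢ) = begin
    det (idOutside P M)               ≈⟨ det-cong (as-subset M) ⟩
    det (idOutside (lookup S) M)      ≈⟨ det-idOutside≈det-sub S M ⟩
    det (sub M S)                     ≈⟨ pme S (i , lookup⇒[]= i S (P.trans (lookup∘tabulate P i) Pᵢ)) ⟩
    det (sub N S)                     ≈⟨ det-idOutside≈det-sub S N ⟨
    det (idOutside (lookup S) N)      ≈⟨ det-cong (as-subset N) ⟨
    det (idOutside P N)               ∎
    where
    S : Subset n
    S = tabulate P
    as-subset : ∀ K → idOutside P K ≈ᴹ idOutside (lookup S) K
    as-subset K i j rewrite lookup∘tabulate P i = refl
  ... | no P-empty = det-cong (λ i j → trans (unit {M} i j) (sym (unit {N} i j)))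
    where
    unit : ∀ {K} i j → idOutside P K i j ≈ idOutside P Iᴹ i j
    unit i j with P i in Pᵢ
    ... | true  = contradiction (i , Pᵢ) P-empty
    ... | false = refl

  idOutside-*ᴹ : ∀ {n} (P : Fin n → Bool) {X C : Matrix n} → (X *ᴹ C) ≈ᴹ Iᴹ → (idOutside P X *ᴹ C) ≈ᴹ idOutside (not ∘ P) C
  idOutside-*ᴹ P {C = C} XC≈I i j with P i
  ... | true  = XC≈I i j
  ... | false = Σ-δ* (λ k → C k j) i

  jacobi : ∀ {n} (P : Fin n → Bool) {X C : Matrix n} → (X *ᴹ C) ≈ᴹ Iᴹ →
           det (idOutside P X) * det C ≈ det (idOutside (not ∘ P) C)
  jacobi P {X} {C} XC≈I = trans (sym (det-*ᴹ (idOutside P X) C)) (det-cong (idOutside-*ᴹ P XC≈I))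

  inverse-≈ₘ : ∀ {n} {X C Y B : Matrix n} → (X *ᴹ C) ≈ᴹ Iᴹ → (Y *ᴹ B) ≈ᴹ Iᴹ → C ≈ₘ B → X ≈ₘ Y
  inverse-≈ₘ {X = X} {C} {Y} {B} XC≈I YB≈I C≈ₘB P = *-cancelʳ-nonzero (rightInverse⇒det≉0 XC≈I) (begin
    det (idOutside P X) * det C  ≈⟨ jacobi P XC≈I ⟩
    det (idOutside (not ∘ P) C)  ≈⟨ C≈ₘB (not ∘ P) ⟩
    det (idOutside (not ∘ P) B)  ≈⟨ jacobi P YB≈I ⟨
    det (idOutside P Y) * det B  ≈⟨ *-congˡ (C≈ₘB (λ _ → true)) ⟨
    det (idOutside P Y) * det C  ∎)

  -- Subtracting a diagonal matrix

  shiftAt : ∀ {n} → Fin n → Carrier → Matrix n → Matrix n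
  shiftAt k a M i j = M i j - a * (δ k i * δ k j)

  without : ∀ {n} → Fin n → (Fin n → Bool) → Fin n → Bool
  without k P i = if does (i ≟ k) then false else P i

  shiftAt-≢ : ∀ {n} {k i : Fin n} a (M : Matrix n) j → k ≢ i → shiftAt k a M i j ≈ M i j
  shiftAt-≢ a M j k≢i = trans (+-congˡ (-‿cong (trans (*-congˡ (trans (*-congʳ (δ-≢ k≢i)) (zeroˡ _))) (zeroʳ a)))) (x-0≈x _)

  idOutside-shiftAt-outside : ∀ {n} (P : Fin n → Bool) (M : Matrix n) {k} a → P k ≡ false →
                              idOutside P (shiftAt k a M) ≈ᴹ idOutside P M
  idOutside-shiftAt-outside P M a Pₖ i j with P i in Pᵢ
  ... | false = refl
  ... | true  = shiftAt-≢ a M j (separates P Pᵢ Pₖ ∘ P.sym)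

  idOutside-shiftAt-inside : ∀ {n} (P : Fin n → Bool) (M : Matrix n) {k} a → P k ≡ true →
    idOutside P (shiftAt k a M) ≈ᴹ (idOutside P M [ k ]≔ (λ j → (- a) * δ k j + idOutside P M k j))
  idOutside-shiftAt-inside P M {k} a Pₖ i j with i ≟ k
  ... | yes P.refl rewrite []≔-updates (idOutside P M) i (λ j → (- a) * δ i j + idOutside P M i j) | Pₖ = begin
    M i j - a * (δ i i * δ i j)     ≈⟨ +-comm _ _ ⟩
    - (a * (δ i i * δ i j)) + M i j ≈⟨ +-congʳ (-‿cong (*-congˡ (trans (*-congʳ (δ-refl i)) (*-identityˡ _)))) ⟩
    - (a * δ i j) + M i j           ≈⟨ +-congʳ (-‿distribˡ-* a (δ i j)) ⟩
    (- a) * δ i j + M i j           ∎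
  ... | no i≢k rewrite []≔-minimal (idOutside P M) k (λ j → (- a) * δ k j + idOutside P M k j) i≢k with P i
  ...   | false = refl
  ...   | true  = shiftAt-≢ a M j (i≢k ∘ P.sym)

  idOutside-[]≔-unitRow : ∀ {n} (P : Fin n → Bool) (M : Matrix n) k → (idOutside P M [ k ]≔ δ k) ≈ᴹ idOutside (without k P) M
  idOutside-[]≔-unitRow P M k i j with i ≟ k
  ... | yes P.refl rewrite []≔-updates (idOutside P M) i (δ i) = refl
  ... | no i≢k rewrite []≔-minimal (idOutside P M) k (δ k) i≢k = refl

  -- Expanding along row k, which changes by -a·e_k.
  det-idOutside-shiftAt : ∀ {n} (P : Fin n → Bool) (M : Matrix n) k a → P k ≡ true →
                          det (idOutside P (shiftAt k a M)) ≈ (- a) * det (idOutside (without k P) M) + det (idOutside P M)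
  det-idOutside-shiftAt P M k a Pₖ = begin
    det (idOutside P (shiftAt k a M))                       ≈⟨ det-cong (idOutside-shiftAt-inside P M a Pₖ) ⟩
    det (L [ k ]≔ (λ j → (- a) * δ k j + L k j))            ≈⟨ det-linear L k (- a) (δ k) (L k) ⟩
    (- a) * det (L [ k ]≔ δ k) + det (L [ k ]≔ L k)         ≈⟨ +-cong (*-congˡ (det-cong (idOutside-[]≔-unitRow P M k))) (det-cong ([]≔-id L k)) ⟩
    (- a) * det (idOutside (without k P) M) + det L         ∎
    where
    L = idOutside P M

  shiftAt-≈ₘ : ∀ {n} {M N : Matrix n} k a → M ≈ₘ N → shiftAt k a M ≈ₘ shiftAt k a N
  shiftAt-≈ₘ {M = M} {N} k a M≈ₘN P with P k in Pₖ
  ... | false = trans (det-cong (idOutside-shiftAt-outside P M a Pₖ))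
                      (trans (M≈ₘN P) (sym (det-cong (idOutside-shiftAt-outside P N a Pₖ))))
  ... | true  = trans (det-idOutside-shiftAt P M k a Pₖ)
                      (trans (+-cong (*-congˡ (M≈ₘN (without k P))) (M≈ₘN P)) (sym (det-idOutside-shiftAt P N k a Pₖ)))

  shiftAll : ∀ {m n} → (Fin m → Fin n) → (Fin n → Carrier) → Matrix n → Matrix n
  shiftAll {zero}  ks d M = M
  shiftAll {suc m} ks d M = shiftAt (ks zero) (d (ks zero)) (shiftAll (ks ∘ suc) d M)

  shiftAll-≈ₘ : ∀ {m n} (ks : Fin m → Fin n) d {M N : Matrix n} → M ≈ₘ N → shiftAll ks d M ≈ₘ shiftAll ks d N
  shiftAll-≈ₘ {zero}  ks d M≈ₘN = M≈ₘN
  shiftAll-≈ₘ {suc m} ks d M≈ₘN = shiftAt-≈ₘ (ks zero) (d (ks zero)) (shiftAll-≈ₘ (ks ∘ suc) d M≈ₘN)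

  shiftAll-entry : ∀ {m n} (ks : Fin m → Fin n) d (M : Matrix n) i j →
                   shiftAll ks d M i j ≈ M i j - Σ (λ t → d (ks t) * (δ (ks t) i * δ (ks t) j))
  shiftAll-entry {zero}  ks d M i j = sym (x-0≈x _)
  shiftAll-entry {suc m} ks d M i j = begin
    shiftAll (ks ∘ suc) d M i j - T                ≈⟨ +-congʳ (shiftAll-entry (ks ∘ suc) d M i j) ⟩
    (M i j - R) - T                                ≈⟨ +-assoc _ _ _ ⟩
    M i j + (- R + - T)                            ≈⟨ +-congˡ (+-comm _ _) ⟩
    M i j + (- T + - R)                            ≈⟨ +-congˡ (⁻¹-∙-comm T R) ⟩
    M i j - (T + R)                                ∎
    where
    T R : Carrier
    T = d (ks zero) * (δ (ks zero) i * δ (ks zero) j)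
    R = Σ (λ t → d (ks (suc t)) * (δ (ks (suc t)) i * δ (ks (suc t)) j))

  Σ-diagonal : ∀ {n} (D : Matrix n) → IsDiagonal D → ∀ i j → Σ (λ t → D t t * (δ t i * δ t j)) ≈ D i j
  Σ-diagonal D D-diagonal i j = begin
    Σ (λ t → D t t * (δ t i * δ t j))   ≈⟨ Σ-cong reorder ⟩
    Σ (λ t → D t t * δ t j * δ t i)     ≈⟨ Σ-*δ (λ t → D t t * δ t j) i ⟩
    D i i * δ i j                       ≈⟨ diagonal-entry ⟩
    D i j                               ∎
    where
    reorder : ∀ t → D t t * (δ t i * δ t j) ≈ D t t * δ t j * δ t i
    reorder t = trans (*-congˡ (*-comm (δ t i) (δ t j))) (sym (*-assoc _ _ _))
    diagonal-entry : D i i * δ i j ≈ D i j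
    diagonal-entry with i ≟ j
    ... | yes P.refl = trans (*-congˡ (δ-refl i)) (*-identityʳ _)
    ... | no i≢j     = trans (*-congˡ (δ-≢ i≢j)) (trans (zeroʳ _) (sym (D-diagonal i j i≢j)))

  shiftAll≈-ᴹ : ∀ {n} (D : Matrix n) → IsDiagonal D → ∀ M → shiftAll (λ k → k) (λ k → D k k) M ≈ᴹ (M -ᴹ D)
  shiftAll≈-ᴹ D D-diagonal M i j = trans (shiftAll-entry (λ k → k) (λ k → D k k) M i j) (+-congˡ (-‿cong (Σ-diagonal D D-diagonal i j)))

  -ᴹ-diagonal-≈ₘ : ∀ {n} (D : Matrix n) → IsDiagonal D → ∀ {M N} → M ≈ₘ N → (M -ᴹ D) ≈ₘ (N -ᴹ D)
  -ᴹ-diagonal-≈ₘ D D-diagonal {M} {N} M≈ₘN P = begin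
    det (idOutside P (M -ᴹ D))                           ≈⟨ det-cong (idOutside-cong P (shiftAll≈-ᴹ D D-diagonal M)) ⟨
    det (idOutside P (shiftAll (λ k → k) (λ k → D k k) M)) ≈⟨ shiftAll-≈ₘ (λ k → k) (λ k → D k k) M≈ₘN P ⟩
    det (idOutside P (shiftAll (λ k → k) (λ k → D k k) N)) ≈⟨ det-cong (idOutside-cong P (shiftAll≈-ᴹ D D-diagonal N)) ⟩
    det (idOutside P (N -ᴹ D))                           ∎

  ≈ₘ-respʳ : ∀ {n} {M N N′ : Matrix n} → N ≈ᴹ N′ → M ≈ₘ N → M ≈ₘ N′
  ≈ₘ-respʳ N≈N′ M≈ₘN P = trans (M≈ₘN P) (det-cong (idOutside-cong P N≈N′))

  +ᴹ-ᴹ-cancelʳ : ∀ {n} (M D : Matrix n) → ((M +ᴹ D) -ᴹ D) ≈ᴹ M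
  +ᴹ-ᴹ-cancelʳ M D i j = trans (+-assoc _ _ _) (trans (+-congˡ (-‿inverseʳ _)) (+-identityʳ _))

lemma4p12 : ∀ {c ℓ} (F : Field c ℓ) (n : ℕ) (A D C B : MatrixOver.Matrix F n)
            → MatrixOver.IsDiagonal F D
            → MatrixOver.IsInverse F (MatrixOver._+ᴹ_ F A D) B
            → MatrixOver.PME F C B
            → Σ[ C⁻¹ ∈ MatrixOver.Matrix F n ]
                (MatrixOver.IsInverse F C C⁻¹ × MatrixOver.PME F (MatrixOver._-ᴹ_ F C⁻¹ D) A)
lemma4p12 F n A D C B D-diagonal (A+D*B≈I , _) C≅B = C⁻¹ , C-inverse , ≈ₘ⇒PME C⁻¹-D≈ₘA
  where
  open Field F using (_≈_; 0#; trans; sym)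
  open MatrixOver F
  open Properties F

  C≈ₘB : C ≈ₘ B
  C≈ₘB = PME⇒≈ₘ C≅B

  detC≉0 : ¬ (det C ≈ 0#)
  detC≉0 detC≈0 = rightInverse⇒det≉0 A+D*B≈I (trans (sym (C≈ₘB (λ _ → true))) detC≈0)

  C⁻¹ : Matrix n
  C⁻¹ = proj₁ (det≉0⇒invertible C detC≉0)

  C-inverse : IsInverse C C⁻¹
  C-inverse = proj₂ (det≉0⇒invertible C detC≉0)

  C⁻¹≈ₘA+D : C⁻¹ ≈ₘ (A +ᴹ D)
  C⁻¹≈ₘA+D = inverse-≈ₘ (proj₂ C-inverse) A+D*B≈I C≈ₘB

  C⁻¹-D≈ₘA : (C⁻¹ -ᴹ D) ≈ₘ A
  C⁻¹-D≈ₘA = ≈ₘ-respʳ (+ᴹ-ᴹ-cancelʳ A D) (-ᴹ-diagonal-≈ₘ D D-diagonal C⁻¹≈ₘA+D)
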